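{- Let $\gamma\ge2$ be an integer and $\mathfrak{t},\mathfrak{t}'$ binary trees. If $\mathfrak{t}\equiv_\gamma\mathfrak{t}'$, then $\mathrm{lr}(\mathfrak{t})\equiv\mathrm{lr}(\mathfrak{t}')\pmod{\gamma-1}$.
   Context: A binary tree is either the leaf or an ordered pair $(\mathfrak{t}_1,\mathfrak{t}_2)$ of binary trees (left and right subtrees). $\mathbf{Mag}$ is the nonsymmetric set-theoretic operad of binary trees ($\mathbf{Mag}(n)$ = trees with $n$ leaves), with $\mathfrak{t}\circ_i\mathfrak{s}$ grafting the root of $\mathfrak{s}$ onto the $i$-th leaf of $\mathfrak{t}$. Combs: $\mathrm{LComb}_1=\mathrm{RComb}_1=(\text{leaf},\text{leaf})$, $\mathrm{LComb}_d=(\mathrm{LComb}_{d-1},\text{leaf})$, $\mathrm{RComb}_d=(\text{leaf},\mathrm{RComb}_{d-1})$. $\equiv_\gamma$ is the smallest operad congruence on $\mathbf{Mag}$ (arity-preserving equivalence relation compatible with all partial compositions) with $\mathrm{LComb}_\gamma\equiv_\gamma\mathrm{RComb}_\gamma$. The left rank $\mathrm{lr}(\mathfrak{t})$ is the number of internal nodes on the path starting at the root and always going to the left child: $\mathrm{lr}(\text{leaf})=0$, $\mathrm{lr}((\mathfrak{t}_1,\mathfrak{t}_2))=1+\mathrm{lr}(\mathfrak{t}_1)$. -}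

module Defs where

open import Data.Nat using (ℕ; zero; suc; _+_; _<_; _∸_; _<?_)
open import Relation.Nullary using (yes; no)

data Tree : Set where
  leaf : Tree
  node : Tree → Tree → Tree

leaves : Tree → ℕ
leaves leaf       = 1
leaves (node l r) = leaves l + leaves r

-- Leaves are numbered 0,1,...,leaves t - 1 from left to right
-- (0-based; the paper's i-th leaf is index i-1 here). Out-of-range indices
-- are never used by the congruence below (it requires i < leaves t).
_∘[_]_ : Tree → ℕ → Tree → Tree
leaf ∘[ zero ] s = s
leaf ∘[ suc i ] s = leaf
node l r ∘[ i ] s with i <? leaves l
... | yes _ = node (l ∘[ i ] s) r
... | no  _ = node l (r ∘[ i ∸ leaves l ] s)

-- Combs (defined for d ≥ 1; LComb 0 = RComb 0 = leaf is an unused convention)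
LComb : ℕ → Tree
LComb zero          = leaf
LComb (suc zero)    = node leaf leaf
LComb (suc (suc d)) = node (LComb (suc d)) leaf

RComb : ℕ → Tree
RComb zero          = leaf
RComb (suc zero)    = node leaf leaf
RComb (suc (suc d)) = node leaf (RComb (suc d))

-- ≡γ : the smallest operad congruence on Mag containing LComb γ ≡ RComb γ,
-- i.e. the smallest equivalence relation containing the generator and
-- compatible with all partial compositions (in both arguments).
data _≡[_]_ : Tree → ℕ → Tree → Set where
  gen   : ∀ {γ} → LComb γ ≡[ γ ] RComb γ
  refl′ : ∀ {γ t} → t ≡[ γ ] t
  sym′  : ∀ {γ t u} → t ≡[ γ ] u → u ≡[ γ ] t
  trans′ : ∀ {γ t u v} → t ≡[ γ ] u → u ≡[ γ ] v → t ≡[ γ ] v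
  comp  : ∀ {γ t t′ s s′} (i : ℕ) → i < leaves t →
          t ≡[ γ ] t′ → s ≡[ γ ] s′ → (t ∘[ i ] s) ≡[ γ ] (t′ ∘[ i ] s′)

lr : Tree → ℕ
lr leaf       = 0
lr (node l r) = suc (lr l)

module Submission where

open import Defs
open import Data.Nat using (ℕ; _≤_; _∸_)
open import Data.Integer using (+_; _-_)
open import Data.Integer.Divisibility using (_∣_)

open import Data.Empty using (⊥-elim)
open import Data.Nat as ℕ using (zero; suc; _<_; _<?_; s≤s; z≤n)
import Data.Nat.Properties as ℕ
open import Data.Integer as ℤ using (ℤ)
import Data.Integer.Properties as ℤ
import Data.Integer.Divisibility.Signed as Signed
open import Data.Integer.Tactic.RingSolver using (solve-∀)
open import Relation.Binary.PropositionalEquality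
  using (_≡_; refl; sym; trans; cong; subst)
open import Relation.Nullary using (yes; no)

-- The left rank is additive under grafting onto the leftmost leaf and
-- unchanged under grafting onto any other leaf, so "left ranks congruent
-- modulo γ − 1" is an operad congruence on Mag.  It relates LComb γ and
-- RComb γ, whose left ranks are γ and 1, and hence contains ≡γ.

infix 4 _≡_[mod_]

record _≡_[mod_] (a b k : ℤ) : Set where
  constructor from-∣
  field to-∣ : k Signed.∣ a - b

open _≡_[mod_]

module _ {k : ℤ} where

  ≡-mod-refl : ∀ a → a ≡ a [mod k ]
  ≡-mod-refl a = from-∣ (Signed.divides ℤ.0ℤ (trans (ℤ.+-inverseʳ a) (sym (ℤ.*-zeroˡ k))))

  ≡-mod-sym : ∀ {a b} → a ≡ b [mod k ] → b ≡ a [mod k ]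
  ≡-mod-sym {a} {b} (from-∣ k∣a-b) =
    from-∣ (subst (k Signed.∣_) (neg-minus a b) (Signed.∣m⇒∣-m k∣a-b))
    where
    neg-minus : ∀ a b → ℤ.- (a - b) ≡ b - a
    neg-minus = solve-∀

  ≡-mod-trans : ∀ {a b c} → a ≡ b [mod k ] → b ≡ c [mod k ] → a ≡ c [mod k ]
  ≡-mod-trans {a} {b} {c} (from-∣ k∣a-b) (from-∣ k∣b-c) =
    from-∣ (subst (k Signed.∣_) (ℤ.+-minus-telescope a b c) (Signed.∣m∣n⇒∣m+n k∣a-b k∣b-c))

  +-cong-mod : ∀ {a a′ b b′} → a ≡ a′ [mod k ] → b ≡ b′ [mod k ] →
               a ℤ.+ b ≡ a′ ℤ.+ b′ [mod k ]
  +-cong-mod {a} {a′} {b} {b′} (from-∣ k∣a-a′) (from-∣ k∣b-b′) =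
    from-∣ (subst (k Signed.∣_) (interchange a a′ b b′) (Signed.∣m∣n⇒∣m+n k∣a-a′ k∣b-b′))
    where
    interchange : ∀ a a′ b b′ → (a - a′) ℤ.+ (b - b′) ≡ (a ℤ.+ b) - (a′ ℤ.+ b′)
    interchange = solve-∀

0<leaves : ∀ t → 0 < leaves t
0<leaves leaf       = s≤s z≤n
0<leaves (node l r) = ℕ.<-≤-trans (0<leaves l) (ℕ.m≤m+n (leaves l) (leaves r))

lr-∘-zero : ∀ t s → lr (t ∘[ 0 ] s) ≡ lr t ℕ.+ lr s
lr-∘-zero leaf       s = refl
lr-∘-zero (node l r) s with 0 <? leaves l
... | yes _   = cong suc (lr-∘-zero l s)
... | no  0≮l = ⊥-elim (0≮l (0<leaves l))

lr-∘-suc : ∀ t i s → lr (t ∘[ suc i ] s) ≡ lr t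
lr-∘-suc leaf       i s = refl
lr-∘-suc (node l r) i s with suc i <? leaves l
... | yes _ = cong suc (lr-∘-suc l i s)
... | no  _ = refl

lr-LComb : ∀ n → lr (LComb n) ≡ n
lr-LComb zero          = refl
lr-LComb (suc zero)    = refl
lr-LComb (suc (suc n)) = cong suc (lr-LComb (suc n))

lr-RComb : ∀ n → lr (RComb (suc n)) ≡ 1
lr-RComb zero    = refl
lr-RComb (suc n) = refl

lr-Comb-mod : ∀ γ → + lr (LComb γ) ≡ + lr (RComb γ) [mod + (γ ∸ 1) ]
lr-Comb-mod zero = ≡-mod-refl ℤ.0ℤ
lr-Comb-mod (suc n) rewrite lr-LComb (suc n) | lr-RComb n = from-∣ Signed.∣-refl

lr-∘-mod : ∀ {k t t′ s s′} i →
           + lr t ≡ + lr t′ [mod k ] → + lr s ≡ + lr s′ [mod k ] →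
           + lr (t ∘[ i ] s) ≡ + lr (t′ ∘[ i ] s′) [mod k ]
lr-∘-mod {t = t} {t′} {s} {s′} zero t≡t′ s≡s′
  rewrite lr-∘-zero t s | lr-∘-zero t′ s′
        | ℤ.pos-+ (lr t) (lr s) | ℤ.pos-+ (lr t′) (lr s′) = +-cong-mod t≡t′ s≡s′
lr-∘-mod {t = t} {t′} {s} {s′} (suc i) t≡t′ _
  rewrite lr-∘-suc t i s | lr-∘-suc t′ i s′ = t≡t′

lr-mod-invariant : ∀ {γ t t′} → t ≡[ γ ] t′ → + lr t ≡ + lr t′ [mod + (γ ∸ 1) ]
lr-mod-invariant {γ} gen        = lr-Comb-mod γ
lr-mod-invariant {t = t} refl′  = ≡-mod-refl (+ lr t)
lr-mod-invariant (sym′ p)       = ≡-mod-sym (lr-mod-invariant p)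
lr-mod-invariant (trans′ p q)   = ≡-mod-trans (lr-mod-invariant p) (lr-mod-invariant q)
lr-mod-invariant (comp i _ p q) = lr-∘-mod i (lr-mod-invariant p) (lr-mod-invariant q)

lemma3p2p6 : (γ : ℕ) → 2 ≤ γ → (t t′ : Tree) → t ≡[ γ ] t′ →
    (+ (γ ∸ 1)) ∣ ((+ lr t) - (+ lr t′))
lemma3p2p6 γ _ t t′ t≡t′ = Signed.∣⇒∣ᵤ (to-∣ (lr-mod-invariant t≡t′))
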